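{- Let $G=(V,E)$ be a finite, connected, symmetric directed graph, $m\ge 1$, and let $L=(v_1,\dots,v_m)$ be a random element of $V^m$ with distribution \[ P[L=(v_1,\dots,v_m)]=\frac{\sum_{i=1}^m\deg(v_i)}{m\,|V|^{m-1}\,\mathrm{vol}(V)} \] (the steady-state distribution of Frontier Sampling with $m$ walkers). Let $V_A\subset V$ be a non-empty proper subset, $V_B=V\setminus V_A$, $p=|V_A|/|V|$, and $d_A=\mathrm{vol}(V_A)/|V_A|$, $d_B=\mathrm{vol}(V_B)/|V_B|$, $d=\mathrm{vol}(V)/|V|$. Let $K_{fs}(m)=|\{i: v_i\in V_A\}|$. Then for $0\le k\le m$, \[ P[K_{fs}(m)=k]=\frac{1}{m\,d}\binom{m}{k}p^k(1-p)^{m-k}\bigl(k\,d_A+(m-k)\,d_B\bigr). \]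
   Context: $\deg(v)$ is the (common) in- and out-degree of $v$ in the symmetric graph $G$ and $\mathrm{vol}(S)=\sum_{v\in S}\deg(v)$. -}

module Defs where

open import Data.Bool using (Bool; true; false; if_then_else_)
open import Data.Nat as ℕ using (ℕ; zero; suc)
open import Data.Integer using (+_)
open import Data.Fin using (Fin)
open import Data.Fin.Subset using (Subset)
open import Data.Vec using (Vec; []; _∷_; lookup)
open import Data.List as List using (List; []; _∷_; concatMap; allFin; filter)
open import Data.Nat.ListAction using () renaming (sum to sumL)
open import Data.Rational as ℚ using (ℚ; 0ℚ; 1ℚ; _÷_; ≢-nonZero)
open import Data.Rational.Properties using (_≟_)
open import Relation.Nullary using (yes; no)
open import Relation.Binary.PropositionalEquality using (_≡_)
open import Data.Product using (_×_)

ℕ→ℚ : ℕ → ℚ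
ℕ→ℚ a = (+ a) ℚ./ 1

-- division of rationals; by convention x ÷₀ 0 = 0 (never used at 0 under the
-- hypotheses of the theorem, where every denominator is positive)
_÷₀_ : ℚ → ℚ → ℚ
p ÷₀ q with q ≟ 0ℚ
... | yes _ = 0ℚ
... | no q≢0 = _÷_ p q {{≢-nonZero q≢0}}

_^ℚ_ : ℚ → ℕ → ℚ
x ^ℚ zero = 1ℚ
x ^ℚ suc k = x ℚ.* (x ^ℚ k)

sumℕ : {A : Set} → List A → (A → ℕ) → ℕ
sumℕ xs f = sumL (List.map f xs)

sumℚ : {A : Set} → List A → (A → ℚ) → ℚ
sumℚ [] f = 0ℚ
sumℚ (x ∷ xs) f = f x ℚ.+ sumℚ xs f

record Digraph (n : ℕ) : Set where
  field
    adj : Fin n → Fin n → Bool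

open Digraph public

Symmetric : {n : ℕ} → Digraph n → Set
Symmetric G = ∀ u v → adj G u v ≡ adj G v u

data Reach {n : ℕ} (G : Digraph n) : Fin n → Fin n → Set where
  here : ∀ {u} → Reach G u u
  step : ∀ {u w v} → adj G u w ≡ true → Reach G w v → Reach G u v

Connected : {n : ℕ} → Digraph n → Set
Connected G = ∀ u v → Reach G u v

-- out-degree (= in-degree for symmetric G)
deg : {n : ℕ} → Digraph n → Fin n → ℕ
deg {n} G v = List.length (filter (λ u → adj G v u ≟b true) (allFin n))
  where
  open import Data.Bool.Properties using () renaming (_≟_ to _≟b_)

countIn : {n : ℕ} → Subset n → List (Fin n) → ℕ
countIn S [] = 0
countIn S (v ∷ vs) = (if lookup S v then 1 else 0) ℕ.+ countIn S vs

vol : {n : ℕ} → Digraph n → Subset n → ℕ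
vol {n} G S = sumℕ (allFin n) (λ v → if lookup S v then deg G v else 0)

allTuples : (n m : ℕ) → List (Vec (Fin n) m)
allTuples n zero = [] ∷ []
allTuples n (suc m) = concatMap (λ v → List.map (v ∷_) (allTuples n m)) (allFin n)

FSprob : {n : ℕ} → Digraph n → (m : ℕ) → Vec (Fin n) m → ℚ
FSprob {n} G m vs =
  ℕ→ℚ (sumL (List.map (deg G) (Data.Vec.toList vs)))
  ÷₀ ℕ→ℚ (m ℕ.* (n ℕ.^ (m ℕ.∸ 1)) ℕ.* vol G (Data.Fin.Subset.⊤))
  where import Data.Vec

Kfs : {n m : ℕ} → Subset n → Vec (Fin n) m → ℕ
Kfs A vs = countIn A (Data.Vec.toList vs)
  where import Data.Vec

probK : {n : ℕ} → Digraph n → (m : ℕ) → Subset n → ℕ → ℚ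
probK {n} G m A k =
  sumℚ (allTuples n m) (λ vs → if ⌊ Kfs A vs ℕ.≟ k ⌋ then FSprob G m vs else 0ℚ)
  where open import Relation.Nullary.Decidable using (⌊_⌋)

module Submission where

-- Write a = |V_A|, b = |V_B|, v_A = vol(V_A), v_B = vol(V_B).  Among the tuples
-- L ∈ V^m with exactly k entries in V_A let N(m,k) be their number and S(m,k) the
-- sum of Σᵢ deg(vᵢ) over them; then P[K_fs(m) = k] = S(m,k) / (m n^(m-1) vol(V)).
-- Splitting off the first vertex of a tuple of length m+1 gives
--   N(m+1,k) = a N(m,k-1) + b N(m,k),
--   S(m+1,k) = v_A N(m,k-1) + a S(m,k-1) + v_B N(m,k) + b S(m,k),
-- and these recurrences are solved by N(m,k) = C(m,k) a^k b^(m-k) and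
-- a b S(m,k) = N(m,k) (k v_A b + (m-k) v_B a).  Dividing by a b m n^(m-1) vol(V)
-- and distributing the factors gives exactly the product in the theorem.

module Recurrence where

  open import Data.Nat
  open import Data.Nat.Properties using (*-zeroʳ; +-∸-assoc; ≰⇒>)
  open import Data.Nat.Combinatorics using (_C_; nCk+nC[k+1]≡[n+1]C[k+1]; k>n⇒nCk≡0)
  open import Data.Nat.Tactic.RingSolver using (solve-∀)
  open import Relation.Binary.PropositionalEquality
  open import Relation.Nullary using (yes; no)

  -- shift f k = f (k - 1), and 0 at k = 0: a tuple whose first vertex is in V_A has
  -- k entries in V_A exactly when its tail has k - 1.
  shift : (ℕ → ℕ) → ℕ → ℕ
  shift f zero = 0
  shift f (suc k) = f k

  -- b · C(m,k+1) b^(m-k-1) = C(m,k+1) b^(m-k): for k < m the exponent grows by one,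
  -- and for k ≥ m the binomial coefficient vanishes.
  absorb-power : ∀ b m k → b * ((m C suc k) * b ^ (m ∸ suc k)) ≡ (m C suc k) * b ^ (m ∸ k)
  absorb-power b m k with suc k ≤? m
  ... | yes k<m = trans (swap b (m C suc k) (b ^ (m ∸ suc k)))
                        (cong (λ e → (m C suc k) * b ^ e) (sym (+-∸-assoc 1 k<m)))
    where
    swap : ∀ b c x → b * (c * x) ≡ c * (b * x)
    swap = solve-∀
  ... | no k≮m rewrite k>n⇒nCk≡0 {m} {suc k} (≰⇒> k≮m) = *-zeroʳ b

  module Solution (a b : ℕ) (N : ℕ → ℕ → ℕ)
    (N-base : N 0 0 ≡ 1) (N-base-suc : ∀ k → N 0 (suc k) ≡ 0)
    (N-step : ∀ m k → N (suc m) k ≡ a * shift (N m) k + b * N m k) where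

    binomial : ∀ m k → N m k ≡ (m C k) * a ^ k * b ^ (m ∸ k)
    binomial zero zero = N-base
    binomial zero (suc k) = N-base-suc k
    binomial (suc m) zero = begin
      N (suc m) 0                   ≡⟨ N-step m 0 ⟩
      a * 0 + b * N m 0             ≡⟨ cong (λ x → a * 0 + b * x) (binomial m 0) ⟩
      a * 0 + b * (1 * 1 * b ^ m)   ≡⟨ pad a b (b ^ m) ⟩
      1 * 1 * b ^ suc m             ∎
      where
      open ≡-Reasoning
      pad : ∀ a b x → a * 0 + b * (1 * 1 * x) ≡ 1 * 1 * (b * x)
      pad = solve-∀
    binomial (suc m) (suc k) = begin
      N (suc m) (suc k)
        ≡⟨ N-step m (suc k) ⟩
      a * N m k + b * N m (suc k)
        ≡⟨ cong₂ (λ x y → a * x + b * y) (binomial m k) (binomial m (suc k)) ⟩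
      a * (c₀ * a ^ k * B) + b * (c₁ * a ^ suc k * B′)
        ≡⟨ cong (a * (c₀ * a ^ k * B) +_) (regroup b c₁ (a ^ suc k) B′) ⟩
      a * (c₀ * a ^ k * B) + a ^ suc k * (b * (c₁ * B′))
        ≡⟨ cong (λ x → a * (c₀ * a ^ k * B) + a ^ suc k * x) (absorb-power b m k) ⟩
      a * (c₀ * a ^ k * B) + a ^ suc k * (c₁ * B)
        ≡⟨ collect a c₀ c₁ (a ^ k) B ⟩
      (c₀ + c₁) * a ^ suc k * B
        ≡⟨ cong (λ c → c * a ^ suc k * B) (nCk+nC[k+1]≡[n+1]C[k+1] m k) ⟩
      (suc m C suc k) * a ^ suc k * B
        ∎
      where
      open ≡-Reasoning
      c₀ = m C k
      c₁ = m C suc k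
      B = b ^ (m ∸ k)
      B′ = b ^ (m ∸ suc k)
      regroup : ∀ b c y x → b * (c * y * x) ≡ y * (b * (c * x))
      regroup = solve-∀
      collect : ∀ a c₀ c₁ y x → a * (c₀ * y * x) + a * y * (c₁ * x) ≡ (c₀ + c₁) * (a * y) * x
      collect = solve-∀

    vanishes : ∀ {m k} → m < k → N m k ≡ 0
    vanishes {m} {k} m<k = trans (binomial m k) (cong (λ c → c * a ^ k * b ^ (m ∸ k)) (k>n⇒nCk≡0 m<k))

    module Weighted (vA vB : ℕ) (S : ℕ → ℕ → ℕ)
      (S-base : ∀ k → S 0 k ≡ 0)
      (S-step : ∀ m k → S (suc m) k ≡ (vA * shift (N m) k + a * shift (S m) k) + (vB * N m k + b * S m k))
      where

      -- a b times the mean degree sum of a tuple with k entries in V_A.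
      weight : ℕ → ℕ → ℕ
      weight m k = k * vA * b + (m ∸ k) * vB * a

      -- Prepending a vertex of V_A adds v_A b to the weight of a tuple in the k - 1 class.
      weight-step-A : ∀ m k →
        shift (N m) k * vA * b + shift (λ j → N m j * weight m j) k ≡ shift (N m) k * weight (suc m) k
      weight-step-A m zero = refl
      weight-step-A m (suc j) = grow (N m j) j (m ∸ j) vA vB a b
        where
        grow : ∀ x j q vA vB a b → x * vA * b + x * (j * vA * b + q * vB * a) ≡ x * (suc j * vA * b + q * vB * a)
        grow = solve-∀

      -- Prepending a vertex of V_B adds v_B a (the class is empty unless k ≤ m).
      weight-step-B : ∀ m k → N m k * vB * a + N m k * weight m k ≡ N m k * weight (suc m) k
      weight-step-B m k with k ≤? m
      ... | yes k≤m = trans (grow (N m k) k (m ∸ k) vA vB a b)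
                            (cong (λ q → N m k * (k * vA * b + q * vB * a)) (sym (+-∸-assoc 1 k≤m)))
        where
        grow : ∀ x k q vA vB a b → x * vB * a + x * (k * vA * b + q * vB * a) ≡ x * (k * vA * b + suc q * vB * a)
        grow = solve-∀
      ... | no k≰m rewrite vanishes (≰⇒> k≰m) = refl

      weighted : ∀ m k → a * b * S m k ≡ N m k * weight m k
      weighted zero zero = trans (cong (a * b *_) (S-base 0)) (trans (*-zeroʳ (a * b)) (sym (*-zeroʳ (N 0 0))))
      weighted zero (suc k) = trans (cong (a * b *_) (S-base (suc k)))
        (trans (*-zeroʳ (a * b)) (cong (_* weight 0 (suc k)) (sym (N-base-suc k))))
      weighted (suc m) k = begin
        a * b * S (suc m) k                                  ≡⟨ cong (a * b *_) (S-step m k) ⟩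
        a * b * ((vA * P + a * Q) + (vB * M + b * R))        ≡⟨ spread a b vA vB P Q M R ⟩
        a * (P * vA * b + a * b * Q) + b * (M * vB * a + a * b * R)
          ≡⟨ cong₂ (λ x y → a * (P * vA * b + x) + b * (M * vB * a + y)) (shifted k) (weighted m k) ⟩
        a * (P * vA * b + shift (λ j → N m j * weight m j) k) + b * (M * vB * a + M * weight m k)
          ≡⟨ cong₂ (λ x y → a * x + b * y) (weight-step-A m k) (weight-step-B m k) ⟩
        a * (P * weight (suc m) k) + b * (M * weight (suc m) k) ≡⟨ factor a b P M (weight (suc m) k) ⟩
        (a * P + b * M) * weight (suc m) k                   ≡⟨ cong (_* weight (suc m) k) (sym (N-step m k)) ⟩
        N (suc m) k * weight (suc m) k                       ∎
        where
        open ≡-Reasoning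
        P = shift (N m) k
        Q = shift (S m) k
        M = N m k
        R = S m k
        shifted : ∀ k → a * b * shift (S m) k ≡ shift (λ j → N m j * weight m j) k
        shifted zero = *-zeroʳ (a * b)
        shifted (suc j) = weighted m j
        spread : ∀ a b vA vB P Q M R → a * b * ((vA * P + a * Q) + (vB * M + b * R))
                   ≡ a * (P * vA * b + a * b * Q) + b * (M * vB * a + a * b * R)
        spread = solve-∀
        factor : ∀ a b P M e → a * (P * e) + b * (M * e) ≡ (a * P + b * M) * e
        factor = solve-∀

module Fraction where

  open import Defs using (ℕ→ℚ; _÷₀_; _^ℚ_)
  open import Data.Nat as ℕ using (ℕ; zero; suc; NonZero)
  import Data.Nat.Properties as ℕP
  open import Data.Integer as ℤ using (+_)
  import Data.Integer.Properties as ℤP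
  open import Data.Rational as ℚ using (ℚ; 0ℚ; 1ℚ; _/_; toℚᵘ; 1/_)
  import Data.Rational.Properties as ℚP
  open import Data.Rational.Unnormalised as ℚᵘ using (mkℚᵘ; *≡*)
  import Data.Rational.Unnormalised.Properties as ℚᵘP
  open import Algebra.Properties.Group ℚP.+-0-group using (//-rightDividesʳ)
  open import Data.Nat.Tactic.RingSolver using (solve-∀)
  open import Relation.Binary.PropositionalEquality
  open import Relation.Nullary using (yes; no)
  open import Data.Empty using (⊥-elim)

  zero-÷₀ : ∀ q → 0ℚ ÷₀ q ≡ 0ℚ
  zero-÷₀ q with q ℚP.≟ 0ℚ
  ... | yes _ = refl
  ... | no q≢0 = ℚP.*-zeroˡ (1/ q)
    where instance _ = ℚ.≢-nonZero q≢0

  ÷₀-unique : ∀ {p q r} → q ≢ 0ℚ → r ℚ.* q ≡ p → p ÷₀ q ≡ r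
  ÷₀-unique {p} {q} {r} q≢0 r*q≡p with q ℚP.≟ 0ℚ
  ... | yes q≡0 = ⊥-elim (q≢0 q≡0)
  ... | no q≢0′ = begin
    p ℚ.* 1/ q          ≡⟨ cong (ℚ._* 1/ q) (sym r*q≡p) ⟩
    (r ℚ.* q) ℚ.* 1/ q  ≡⟨ ℚP.*-assoc r q (1/ q) ⟩
    r ℚ.* (q ℚ.* 1/ q)  ≡⟨ cong (r ℚ.*_) (ℚP.*-inverseʳ q) ⟩
    r ℚ.* 1ℚ            ≡⟨ ℚP.*-identityʳ r ⟩
    r                   ∎
    where
    open ≡-Reasoning
    instance _ = ℚ.≢-nonZero q≢0′

  ÷₀-distrib-+ : ∀ p r q → (p ÷₀ q) ℚ.+ (r ÷₀ q) ≡ (p ℚ.+ r) ÷₀ q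
  ÷₀-distrib-+ p r q with q ℚP.≟ 0ℚ
  ... | yes _ = refl
  ... | no q≢0 = sym (ℚP.*-distribʳ-+ (1/ q) p r)
    where instance _ = ℚ.≢-nonZero q≢0

  private
    toℚᵘ-/ : ∀ x d → toℚᵘ (+ x / suc d) ℚᵘ.≃ mkℚᵘ (+ x) d
    toℚᵘ-/ x d = ℚP.toℚᵘ-fromℚᵘ (mkℚᵘ (+ x) d)

  /-cross : ∀ x y d e .{{_ : NonZero d}} .{{_ : NonZero e}} → x ℕ.* e ≡ y ℕ.* d → + x / d ≡ + y / e
  /-cross x y (suc d) (suc e) eq = ℚP.fromℚᵘ-cong {mkℚᵘ (+ x) d} {mkℚᵘ (+ y) e} (*≡* (begin
    + x ℤ.* + suc e   ≡⟨ ℤP.pos-* x (suc e) ⟨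
    + (x ℕ.* suc e)   ≡⟨ cong +_ eq ⟩
    + (y ℕ.* suc d)   ≡⟨ ℤP.pos-* y (suc d) ⟩
    + y ℤ.* + suc d   ∎))
    where open ≡-Reasoning

  /-mul : ∀ x y d e .{{_ : NonZero d}} .{{_ : NonZero e}} →
    (+ x / d) ℚ.* (+ y / e) ≡ _/_ (+ (x ℕ.* y)) (d ℕ.* e) {{ℕP.m*n≢0 d e}}
  /-mul x y (suc d) (suc e) = ℚP.toℚᵘ-injective (begin
    toℚᵘ ((+ x / suc d) ℚ.* (+ y / suc e))         ≈⟨ ℚP.toℚᵘ-homo-* (+ x / suc d) (+ y / suc e) ⟩
    toℚᵘ (+ x / suc d) ℚᵘ.* toℚᵘ (+ y / suc e)     ≈⟨ ℚᵘP.*-cong (toℚᵘ-/ x d) (toℚᵘ-/ y e) ⟩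
    mkℚᵘ (+ x ℤ.* + y) (ℕ.pred (suc d ℕ.* suc e))  ≈⟨ ℚᵘP.≃-reflexive (cong (λ i → mkℚᵘ i _) (sym (ℤP.pos-* x y))) ⟩
    mkℚᵘ (+ (x ℕ.* y)) (ℕ.pred (suc d ℕ.* suc e))  ≈⟨ ℚᵘP.≃-sym (toℚᵘ-/ (x ℕ.* y) _) ⟩
    toℚᵘ (+ (x ℕ.* y) / (suc d ℕ.* suc e))         ∎)
    where open ℚᵘP.≃-Reasoning

  /-add : ∀ x y d e .{{_ : NonZero d}} .{{_ : NonZero e}} →
    (+ x / d) ℚ.+ (+ y / e) ≡ _/_ (+ (x ℕ.* e ℕ.+ y ℕ.* d)) (d ℕ.* e) {{ℕP.m*n≢0 d e}}
  /-add x y (suc d) (suc e) = ℚP.toℚᵘ-injective (begin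
    toℚᵘ ((+ x / suc d) ℚ.+ (+ y / suc e))         ≈⟨ ℚP.toℚᵘ-homo-+ (+ x / suc d) (+ y / suc e) ⟩
    toℚᵘ (+ x / suc d) ℚᵘ.+ toℚᵘ (+ y / suc e)     ≈⟨ ℚᵘP.+-cong (toℚᵘ-/ x d) (toℚᵘ-/ y e) ⟩
    mkℚᵘ (+ x ℤ.* + suc e ℤ.+ + y ℤ.* + suc d) (ℕ.pred (suc d ℕ.* suc e))
      ≈⟨ ℚᵘP.≃-reflexive (cong (λ i → mkℚᵘ i _) (sym numerator)) ⟩
    mkℚᵘ (+ (x ℕ.* suc e ℕ.+ y ℕ.* suc d)) (ℕ.pred (suc d ℕ.* suc e))
      ≈⟨ ℚᵘP.≃-sym (toℚᵘ-/ (x ℕ.* suc e ℕ.+ y ℕ.* suc d) _) ⟩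
    toℚᵘ (+ (x ℕ.* suc e ℕ.+ y ℕ.* suc d) / (suc d ℕ.* suc e)) ∎)
    where
    open ℚᵘP.≃-Reasoning
    numerator : + (x ℕ.* suc e ℕ.+ y ℕ.* suc d) ≡ + x ℤ.* + suc e ℤ.+ + y ℤ.* + suc d
    numerator = trans (ℤP.pos-+ (x ℕ.* suc e) (y ℕ.* suc d))
                      (cong₂ ℤ._+_ (ℤP.pos-* x (suc e)) (ℤP.pos-* y (suc d)))

  /-≢0 : ∀ x d .{{_ : NonZero d}} → + suc x / d ≢ 0ℚ
  /-≢0 x (suc d) eq with ℚᵘP.≃-trans (ℚᵘP.≃-sym (toℚᵘ-/ (suc x) d)) (ℚP.toℚᵘ-cong eq)
  ... | *≡* ()

  -- frac x d is the quotient x ÷₀ d of naturals as it is written in the theorem.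
  -- Multiplication, powers and cancellation hold for all d; the remaining laws need d ≠ 0.

  frac : ℕ → ℕ → ℚ
  frac x d = ℕ→ℚ x ÷₀ ℕ→ℚ d

  frac-/ : ∀ x d .{{_ : NonZero d}} → frac x d ≡ + x / d
  frac-/ x d@(suc d-1) = ÷₀-unique (/-≢0 d-1 1)
    (trans (/-mul x d d 1) (/-cross (x ℕ.* d) x (d ℕ.* 1) 1 (ℕP.*-assoc x d 1)))

  frac-1 : ∀ x → frac x 1 ≡ ℕ→ℚ x
  frac-1 x = frac-/ x 1

  frac-mul : ∀ x y d e → frac x d ℚ.* frac y e ≡ frac (x ℕ.* y) (d ℕ.* e)
  frac-mul x y zero e = ℚP.*-zeroˡ (frac y e)
  frac-mul x y d@(suc _) zero = trans (ℚP.*-zeroʳ (frac x d)) (sym (cong (frac (x ℕ.* y)) (ℕP.*-zeroʳ d)))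
  frac-mul x y d@(suc _) e@(suc _) = begin
    frac x d ℚ.* frac y e           ≡⟨ cong₂ ℚ._*_ (frac-/ x d) (frac-/ y e) ⟩
    (+ x / d) ℚ.* (+ y / e)         ≡⟨ /-mul x y d e ⟩
    + (x ℕ.* y) / (d ℕ.* e)         ≡⟨ frac-/ (x ℕ.* y) (d ℕ.* e) ⟨
    frac (x ℕ.* y) (d ℕ.* e)        ∎
    where open ≡-Reasoning

  frac-cross : ∀ x y d e .{{_ : NonZero d}} .{{_ : NonZero e}} → x ℕ.* e ≡ y ℕ.* d → frac x d ≡ frac y e
  frac-cross x y d e eq = trans (frac-/ x d) (trans (/-cross x y d e eq) (sym (frac-/ y e)))

  frac-cancel : ∀ x d c .{{_ : NonZero c}} → frac (x ℕ.* c) (d ℕ.* c) ≡ frac x d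
  frac-cancel x zero c = refl
  frac-cancel x d@(suc _) c = frac-cross (x ℕ.* c) x (d ℕ.* c) d {{ℕP.m*n≢0 d c}} (swap x c d)
    where
    swap : ∀ x c d → x ℕ.* c ℕ.* d ≡ x ℕ.* (d ℕ.* c)
    swap = solve-∀

  frac-add : ∀ x y d e .{{_ : NonZero d}} .{{_ : NonZero e}} →
    frac x d ℚ.+ frac y e ≡ frac (x ℕ.* e ℕ.+ y ℕ.* d) (d ℕ.* e)
  frac-add x y d e = trans (cong₂ ℚ._+_ (frac-/ x d) (frac-/ y e))
    (trans (/-add x y d e) (sym (frac-/ (x ℕ.* e ℕ.+ y ℕ.* d) (d ℕ.* e) {{ℕP.m*n≢0 d e}})))

  frac-pow : ∀ x d k → frac x d ^ℚ k ≡ frac (x ℕ.^ k) (d ℕ.^ k)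
  frac-pow x d zero = refl
  frac-pow x d (suc k) = trans (cong (frac x d ℚ.*_) (frac-pow x d k)) (frac-mul x (x ℕ.^ k) d (d ℕ.^ k))

  frac-scale : ∀ k x d → ℕ→ℚ k ℚ.* frac x d ≡ frac (k ℕ.* x) d
  frac-scale k x d = trans (cong (ℚ._* frac x d) (sym (frac-1 k)))
    (trans (frac-mul k x 1 d) (cong (frac (k ℕ.* x)) (ℕP.*-identityˡ d)))

  -- 1 ÷₀ (x/d) = d/x, including x = 0 where both sides are 0.
  frac-inv : ∀ x d .{{_ : NonZero d}} → ℕ→ℚ 1 ÷₀ frac x d ≡ frac d x
  frac-inv zero d = cong (ℕ→ℚ 1 ÷₀_) (trans (frac-/ 0 d) (ℚP.0/n≡0 d))
  frac-inv x@(suc x-1) d = ÷₀-unique (λ eq → /-≢0 x-1 d (trans (sym (frac-/ x d)) eq)) (begin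
    frac d x ℚ.* frac x d        ≡⟨ frac-mul d x x d ⟩
    frac (d ℕ.* x) (x ℕ.* d)     ≡⟨ frac-cross (d ℕ.* x) 1 (x ℕ.* d) 1 {{ℕP.m*n≢0 x d}} (comm d x) ⟩
    frac 1 1                     ≡⟨ frac-1 1 ⟩
    ℕ→ℚ 1                        ∎)
    where
    open ≡-Reasoning
    comm : ∀ d x → d ℕ.* x ℕ.* 1 ≡ 1 ℕ.* (x ℕ.* d)
    comm = solve-∀

  frac-complement : ∀ a b d .{{_ : NonZero d}} → b ℕ.+ a ≡ d → ℕ→ℚ 1 ℚ.- frac a d ≡ frac b d
  frac-complement a b d b+a≡d = begin
    ℕ→ℚ 1 ℚ.- frac a d                      ≡⟨ cong (ℚ._- frac a d) whole ⟩
    (frac b d ℚ.+ frac a d) ℚ.- frac a d    ≡⟨ //-rightDividesʳ (frac a d) (frac b d) ⟩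
    frac b d                                ∎
    where
    open ≡-Reasoning
    distrib : ∀ b a d → (b ℕ.* d ℕ.+ a ℕ.* d) ℕ.* 1 ≡ 1 ℕ.* ((b ℕ.+ a) ℕ.* d)
    distrib = solve-∀
    whole : ℕ→ℚ 1 ≡ frac b d ℚ.+ frac a d
    whole = sym (trans (frac-add b a d d) (trans (frac-cross (b ℕ.* d ℕ.+ a ℕ.* d) 1 (d ℕ.* d) 1 {{ℕP.m*n≢0 d d}}
      (trans (distrib b a d) (cong (λ s → 1 ℕ.* (s ℕ.* d)) b+a≡d))) (frac-1 1)))

  ℕ→ℚ-+ : ∀ x y → ℕ→ℚ (x ℕ.+ y) ≡ ℕ→ℚ x ℚ.+ ℕ→ℚ y
  ℕ→ℚ-+ x y = sym (trans (/-add x y 1 1) (/-cross (x ℕ.* 1 ℕ.+ y ℕ.* 1) (x ℕ.+ y) 1 1 (unit x y)))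
    where
    unit : ∀ x y → (x ℕ.* 1 ℕ.+ y ℕ.* 1) ℕ.* 1 ≡ (x ℕ.+ y) ℕ.* (1 ℕ.* 1)
    unit = solve-∀

module Sums where

  open import Defs
  open Fraction using (ℕ→ℚ-+; ÷₀-distrib-+; zero-÷₀)
  open import Data.Bool using (Bool; true; false; if_then_else_)
  open import Data.Nat as ℕ using (ℕ; zero; suc; _+_; _*_)
  import Data.Nat.Properties as ℕP
  open import Data.Fin as Fin using (Fin)
  open import Data.Fin.Subset using (Subset; ∣_∣; ∁)
  open import Data.Vec using (Vec; []; _∷_; lookup)
  open import Data.List as List using (List; []; _∷_; allFin; concatMap; tabulate)
  import Data.List.Properties as ListP
  open import Data.Nat.ListAction using () renaming (sum to sumL)
  open import Data.Nat.ListAction.Properties using (sum-++)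
  open import Data.Rational as ℚ using (ℚ; 0ℚ)
  import Data.Rational.Properties as ℚP
  open import Algebra.Properties.CommutativeSemigroup ℕP.+-commutativeSemigroup using (x∙yz≈y∙xz)
  open import Data.Nat.Tactic.RingSolver using (solve-∀)
  open import Function using (_∘_; id)
  open import Relation.Binary.PropositionalEquality

  sumℕ-cong : ∀ {X : Set} (xs : List X) {f g : X → ℕ} → (∀ x → f x ≡ g x) → sumℕ xs f ≡ sumℕ xs g
  sumℕ-cong xs f≗g = cong sumL (ListP.map-cong f≗g xs)

  sumℕ-zero : ∀ {X : Set} (xs : List X) → sumℕ xs (λ _ → 0) ≡ 0
  sumℕ-zero [] = refl
  sumℕ-zero (x ∷ xs) = sumℕ-zero xs

  sumℕ-concatMap : ∀ {X Y : Set} (xs : List X) (g : X → List Y) (h : Y → ℕ) →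
    sumℕ (concatMap g xs) h ≡ sumℕ xs (λ x → sumℕ (g x) h)
  sumℕ-concatMap [] g h = refl
  sumℕ-concatMap (x ∷ xs) g h = begin
    sumL (List.map h (g x List.++ concatMap g xs))              ≡⟨ cong sumL (ListP.map-++ h (g x) (concatMap g xs)) ⟩
    sumL (List.map h (g x) List.++ List.map h (concatMap g xs)) ≡⟨ sum-++ (List.map h (g x)) _ ⟩
    sumℕ (g x) h + sumℕ (concatMap g xs) h                       ≡⟨ cong (sumℕ (g x) h +_) (sumℕ-concatMap xs g h) ⟩
    sumℕ (g x) h + sumℕ xs (λ x → sumℕ (g x) h)                  ∎
    where open ≡-Reasoning

  sumℕ-map : ∀ {X Y : Set} (xs : List X) (f : X → Y) (h : Y → ℕ) →
    sumℕ (List.map f xs) h ≡ sumℕ xs (h ∘ f)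
  sumℕ-map xs f h = cong sumL (sym (ListP.map-∘ xs))

  sumℕ-restrict-+ : ∀ {X : Set} (xs : List X) (c : X → Bool) (d : ℕ) (g : X → ℕ) →
    sumℕ xs (λ x → if c x then d + g x else 0) ≡
    d * sumℕ xs (λ x → if c x then 1 else 0) + sumℕ xs (λ x → if c x then g x else 0)
  sumℕ-restrict-+ [] c d g = sym (cong (_+ 0) (ℕP.*-zeroʳ d))
  sumℕ-restrict-+ (x ∷ xs) c d g with c x
  ... | true = trans (cong (d + g x +_) (sumℕ-restrict-+ xs c d g)) (regroup d (g x) _ _)
    where
    regroup : ∀ d y s t → d + y + (d * s + t) ≡ d * (1 + s) + (y + t)
    regroup = solve-∀
  ... | false = sumℕ-restrict-+ xs c d g

  sumℚ-÷₀ : ∀ {X : Set} (xs : List X) (c : X → Bool) (g : X → ℕ) (q : ℚ) →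
    sumℚ xs (λ x → if c x then ℕ→ℚ (g x) ÷₀ q else 0ℚ)
    ≡ ℕ→ℚ (sumℕ xs (λ x → if c x then g x else 0)) ÷₀ q
  sumℚ-÷₀ [] c g q = sym (zero-÷₀ q)
  sumℚ-÷₀ (x ∷ xs) c g q with c x
  ... | true = trans (cong (ℕ→ℚ (g x) ÷₀ q ℚ.+_) (sumℚ-÷₀ xs c g q))
    (trans (÷₀-distrib-+ (ℕ→ℚ (g x)) _ q) (cong (_÷₀ q) (sym (ℕ→ℚ-+ (g x) _))))
  ... | false = trans (ℚP.+-identityˡ _) (sumℚ-÷₀ xs c g q)

  Σ : (n : ℕ) → (Fin n → ℕ) → ℕ
  Σ zero f = 0
  Σ (suc n) f = f Fin.zero + Σ n (f ∘ Fin.suc)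

  Σ-cong : ∀ n {f g : Fin n → ℕ} → (∀ v → f v ≡ g v) → Σ n f ≡ Σ n g
  Σ-cong zero f≗g = refl
  Σ-cong (suc n) f≗g = cong₂ _+_ (f≗g Fin.zero) (Σ-cong n (f≗g ∘ Fin.suc))

  sumℕ-allFin : ∀ n (f : Fin n → ℕ) → sumℕ (allFin n) f ≡ Σ n f
  sumℕ-allFin n f = trans (cong sumL (ListP.map-tabulate id f)) (sum-tabulate n f)
    where
    sum-tabulate : ∀ n (f : Fin n → ℕ) → sumL (tabulate f) ≡ Σ n f
    sum-tabulate zero f = refl
    sum-tabulate (suc n) f = cong (f Fin.zero +_) (sum-tabulate n (f ∘ Fin.suc))

  ΣIn : ∀ {n} → Subset n → (Fin n → ℕ) → ℕ
  ΣIn {n} A f = Σ n (λ v → if lookup A v then f v else 0)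

  Σ-split : ∀ {n} (A : Subset n) (f g : Fin n → ℕ) →
    Σ n (λ v → if lookup A v then f v else g v) ≡ ΣIn A f + ΣIn (∁ A) g
  Σ-split [] f g = refl
  Σ-split (true ∷ A) f g =
    trans (cong (f Fin.zero +_) (Σ-split A (f ∘ Fin.suc) (g ∘ Fin.suc))) (sym (ℕP.+-assoc (f Fin.zero) _ _))
  Σ-split (false ∷ A) f g =
    trans (cong (g Fin.zero +_) (Σ-split A (f ∘ Fin.suc) (g ∘ Fin.suc)))
          (x∙yz≈y∙xz (g Fin.zero) (ΣIn A (f ∘ Fin.suc)) (ΣIn (∁ A) (g ∘ Fin.suc)))

  ΣIn-const : ∀ {n} (A : Subset n) (c : ℕ) → ΣIn A (λ _ → c) ≡ ∣ A ∣ * c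
  ΣIn-const [] c = refl
  ΣIn-const (true ∷ A) c = cong (c +_) (ΣIn-const A c)
  ΣIn-const (false ∷ A) c = ΣIn-const A c

  ΣIn-linear : ∀ {n} (A : Subset n) (f : Fin n → ℕ) (c d : ℕ) →
    ΣIn A (λ v → f v * c + d) ≡ ΣIn A f * c + ∣ A ∣ * d
  ΣIn-linear [] f c d = refl
  ΣIn-linear (true ∷ A) f c d =
    trans (cong (f Fin.zero * c + d +_) (ΣIn-linear A (f ∘ Fin.suc) c d))
          (regroup (f Fin.zero) c d (ΣIn A (f ∘ Fin.suc)) ∣ A ∣)
    where
    regroup : ∀ x c d y z → x * c + d + (y * c + z * d) ≡ (x + y) * c + (1 + z) * d
    regroup = solve-∀
  ΣIn-linear (false ∷ A) f c d = ΣIn-linear A (f ∘ Fin.suc) c d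

  vol-ΣIn : ∀ {n} (G : Digraph n) (B : Subset n) → vol G B ≡ ΣIn B (deg G)
  vol-ΣIn {n} G B = sumℕ-allFin n _

  sumℕ-tuples : ∀ n m (h : Vec (Fin n) (suc m) → ℕ) →
    sumℕ (allTuples n (suc m)) h ≡ Σ n (λ v → sumℕ (allTuples n m) (h ∘ (v ∷_)))
  sumℕ-tuples n m h = begin
    sumℕ (concatMap (λ v → List.map (v ∷_) (allTuples n m)) (allFin n)) h
      ≡⟨ sumℕ-concatMap (allFin n) _ h ⟩
    sumℕ (allFin n) (λ v → sumℕ (List.map (v ∷_) (allTuples n m)) h)
      ≡⟨ sumℕ-cong (allFin n) (λ v → sumℕ-map (allTuples n m) (v ∷_) h) ⟩
    sumℕ (allFin n) (λ v → sumℕ (allTuples n m) (h ∘ (v ∷_)))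
      ≡⟨ sumℕ-allFin n _ ⟩
    Σ n (λ v → sumℕ (allTuples n m) (h ∘ (v ∷_)))  ∎
    where open ≡-Reasoning

module Tuples where

  open import Defs
  open Recurrence using (shift)
  open Sums
  open import Data.Bool using (Bool; true; false; if_then_else_)
  open import Data.Nat as ℕ using (ℕ; zero; suc; _+_; _*_)
  open import Data.Fin using (Fin)
  open import Data.Fin.Subset using (Subset; ∣_∣; ∁; ⊤)
  open import Data.Vec using (Vec; _∷_; lookup; toList)
  open import Relation.Nullary.Decidable using (⌊_⌋; isYes≗does)
  open import Function using (_∘_)
  open import Relation.Binary.PropositionalEquality

  -- Both sides compute to the boolean test x ≡ᵇ k.
  ≟-suc : ∀ x k → ⌊ suc x ℕ.≟ suc k ⌋ ≡ ⌊ x ℕ.≟ k ⌋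
  ≟-suc x k = trans (isYes≗does (suc x ℕ.≟ suc k)) (sym (isYes≗does (x ℕ.≟ k)))

  module Counts {n : ℕ} (G : Digraph n) (A : Subset n) where

    hasK : ∀ {m} → ℕ → Vec (Fin n) m → Bool
    hasK k L = ⌊ Kfs A L ℕ.≟ k ⌋

    degSum : ∀ {m} → Vec (Fin n) m → ℕ
    degSum L = sumℕ (toList L) (deg G)

    restricted : (m k : ℕ) → (Vec (Fin n) m → ℕ) → ℕ
    restricted m k w = sumℕ (allTuples n m) (λ L → if hasK k L then w L else 0)

    count : ℕ → ℕ → ℕ
    count m k = restricted m k (λ _ → 1)

    degTotal : ℕ → ℕ → ℕ
    degTotal m k = restricted m k degSum

    restricted-cons : ∀ m k (β : Bool) (w : Vec (Fin n) m → ℕ) →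
      sumℕ (allTuples n m) (λ L → if ⌊ (if β then 1 else 0) + Kfs A L ℕ.≟ k ⌋ then w L else 0)
      ≡ (if β then shift (λ j → restricted m j w) k else restricted m k w)
    restricted-cons m k false w = refl
    restricted-cons m zero true w = sumℕ-zero (allTuples n m)
    restricted-cons m (suc k) true w =
      sumℕ-cong (allTuples n m) (λ L → cong (λ c → if c then w L else 0) (≟-suc (Kfs A L) k))

    degTotal-cons : ∀ m k (v : Fin n) →
      sumℕ (allTuples n m) (λ L → if hasK k (v ∷ L) then degSum (v ∷ L) else 0)
      ≡ (if lookup A v then deg G v * shift (count m) k + shift (degTotal m) k
                       else deg G v * count m k + degTotal m k)
    degTotal-cons m k v = begin
      sumℕ (allTuples n m) (λ L → if hasK k (v ∷ L) then deg G v + degSum L else 0)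
        ≡⟨ sumℕ-restrict-+ (allTuples n m) (hasK k ∘ (v ∷_)) (deg G v) degSum ⟩
      deg G v * sumℕ (allTuples n m) (λ L → if hasK k (v ∷ L) then 1 else 0)
        + sumℕ (allTuples n m) (λ L → if hasK k (v ∷ L) then degSum L else 0)
        ≡⟨ cong₂ (λ x y → deg G v * x + y) (restricted-cons m k β (λ _ → 1)) (restricted-cons m k β degSum) ⟩
      deg G v * (if β then P else N) + (if β then Q else S)
        ≡⟨ merge β ⟩
      (if β then deg G v * P + Q else deg G v * N + S) ∎
      where
      open ≡-Reasoning
      β = lookup A v
      P = shift (count m) k
      Q = shift (degTotal m) k
      N = count m k
      S = degTotal m k
      merge : ∀ β → deg G v * (if β then P else N) + (if β then Q else S)
                    ≡ (if β then deg G v * P + Q else deg G v * N + S)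
      merge true = refl
      merge false = refl

    count-step : ∀ m k → count (suc m) k ≡ ∣ A ∣ * shift (count m) k + ∣ ∁ A ∣ * count m k
    count-step m k = begin
      count (suc m) k
        ≡⟨ sumℕ-tuples n m _ ⟩
      Σ n (λ v → sumℕ (allTuples n m) (λ L → if hasK k (v ∷ L) then 1 else 0))
        ≡⟨ Σ-cong n (λ v → restricted-cons m k (lookup A v) (λ _ → 1)) ⟩
      Σ n (λ v → if lookup A v then shift (count m) k else count m k)
        ≡⟨ Σ-split A _ _ ⟩
      ΣIn A (λ _ → shift (count m) k) + ΣIn (∁ A) (λ _ → count m k)
        ≡⟨ cong₂ _+_ (ΣIn-const A (shift (count m) k)) (ΣIn-const (∁ A) (count m k)) ⟩
      ∣ A ∣ * shift (count m) k + ∣ ∁ A ∣ * count m k ∎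
      where open ≡-Reasoning

    degTotal-step : ∀ m k → degTotal (suc m) k ≡
      (vol G A * shift (count m) k + ∣ A ∣ * shift (degTotal m) k) + (vol G (∁ A) * count m k + ∣ ∁ A ∣ * degTotal m k)
    degTotal-step m k = begin
      degTotal (suc m) k
        ≡⟨ sumℕ-tuples n m _ ⟩
      Σ n (λ v → sumℕ (allTuples n m) (λ L → if hasK k (v ∷ L) then degSum (v ∷ L) else 0))
        ≡⟨ Σ-cong n (degTotal-cons m k) ⟩
      Σ n (λ v → if lookup A v then deg G v * P + Q else deg G v * N + S)
        ≡⟨ Σ-split A _ _ ⟩
      ΣIn A (λ v → deg G v * P + Q) + ΣIn (∁ A) (λ v → deg G v * N + S)
        ≡⟨ cong₂ _+_ (ΣIn-linear A (deg G) P Q) (ΣIn-linear (∁ A) (deg G) N S) ⟩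
      (ΣIn A (deg G) * P + ∣ A ∣ * Q) + (ΣIn (∁ A) (deg G) * N + ∣ ∁ A ∣ * S)
        ≡⟨ cong₂ (λ x y → (x * P + ∣ A ∣ * Q) + (y * N + ∣ ∁ A ∣ * S)) (vol-ΣIn G A) (vol-ΣIn G (∁ A)) ⟨
      (vol G A * P + ∣ A ∣ * Q) + (vol G (∁ A) * N + ∣ ∁ A ∣ * S) ∎
      where
      open ≡-Reasoning
      P = shift (count m) k
      Q = shift (degTotal m) k
      N = count m k
      S = degTotal m k

    degTotal-base : ∀ k → degTotal 0 k ≡ 0
    degTotal-base zero = refl
    degTotal-base (suc k) = refl

    probK-as-fraction : ∀ m k →
      probK G m A k ≡ ℕ→ℚ (degTotal m k) ÷₀ ℕ→ℚ (m * n ℕ.^ (m ℕ.∸ 1) * vol G ⊤)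
    probK-as-fraction m k = sumℚ-÷₀ (allTuples n m) (hasK k) degSum (ℕ→ℚ (m * n ℕ.^ (m ℕ.∸ 1) * vol G ⊤))

open import Defs
open import Data.Nat using (ℕ; _≤_; _<_)
open import Data.Nat.Combinatorics using (_C_)
open import Data.Fin.Subset using (Subset; ∣_∣; ∁; ⊤)
open import Data.Rational using (_*_; _+_)
open import Relation.Binary.PropositionalEquality using (_≡_)

open Recurrence using (module Solution)
open Fraction
open Tuples using (module Counts)
open import Data.Nat as ℕ using (suc; NonZero; s≤s; z≤n)
import Data.Nat.Properties as ℕP
import Data.Rational as ℚ
open import Data.Fin.Subset.Properties using (∣∁p∣≡n∸∣p∣; ∣p∣≤n)
open import Data.Nat.Tactic.RingSolver using (solve-∀)
open import Relation.Binary.PropositionalEquality using (refl; sym; trans; cong; cong₂; subst; module ≡-Reasoning)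

-- The right-hand side of the theorem in terms of n = |V|, a = |V_A|, b = |V_B|, m,
-- V = vol(V), v_A, v_B, binom = C(m,k), k and j = m - k.
fsFormula : (n a b m V vA vB binom k j : ℕ) → ℚ.ℚ
fsFormula n a b m V vA vB binom k j =
  (ℕ→ℚ 1 ÷₀ (ℕ→ℚ m * frac V n))
  * ℕ→ℚ binom
  * (frac a n ^ℚ k)
  * ((ℕ→ℚ 1 ℚ.- frac a n) ^ℚ j)
  * (ℕ→ℚ k * frac vA a + ℕ→ℚ j * frac vB b)

-- The counting identity a b S = C(m,k) a^k b^j (k v_A b + j v_B a), together with
-- n^k n^j = n^(p+1), turns S / (m n^p V) into the product formula: each factor is a
-- fraction of naturals, their product is one fraction, and it is S / (m n^p V)
-- with numerator and denominator multiplied by n a b.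
fsFormula-from-count : ∀ n a b m V vA vB S binom k j p .{{_ : NonZero n}} .{{_ : NonZero a}} .{{_ : NonZero b}} →
  b ℕ.+ a ≡ n →
  a ℕ.* b ℕ.* S ≡ binom ℕ.* a ℕ.^ k ℕ.* b ℕ.^ j ℕ.* (k ℕ.* vA ℕ.* b ℕ.+ j ℕ.* vB ℕ.* a) →
  n ℕ.^ k ℕ.* n ℕ.^ j ≡ n ℕ.* n ℕ.^ p →
  frac S (m ℕ.* n ℕ.^ p ℕ.* V) ≡ fsFormula n a b m V vA vB binom k j
fsFormula-from-count n a b m V vA vB S binom k j p b+a≡n count-eq power-eq = sym (begin
  fsFormula n a b m V vA vB binom k j
    ≡⟨ cong₂ _*_ (cong₂ _*_ (cong₂ _*_ (cong₂ _*_ normaliser (sym (frac-1 binom))) (frac-pow a n k)) share-B) mean-degree ⟩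
  frac n (m ℕ.* V) * frac binom 1 * frac (a ℕ.^ k) (n ℕ.^ k) * frac (b ℕ.^ j) (n ℕ.^ j) * frac E (a ℕ.* b)
    ≡⟨ cong (λ z → z * frac (a ℕ.^ k) (n ℕ.^ k) * frac (b ℕ.^ j) (n ℕ.^ j) * frac E (a ℕ.* b)) (frac-mul n binom (m ℕ.* V) 1) ⟩
  frac X₁ Y₁ * frac (a ℕ.^ k) (n ℕ.^ k) * frac (b ℕ.^ j) (n ℕ.^ j) * frac E (a ℕ.* b)
    ≡⟨ cong (λ z → z * frac (b ℕ.^ j) (n ℕ.^ j) * frac E (a ℕ.* b)) (frac-mul X₁ (a ℕ.^ k) Y₁ (n ℕ.^ k)) ⟩
  frac X₂ Y₂ * frac (b ℕ.^ j) (n ℕ.^ j) * frac E (a ℕ.* b)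
    ≡⟨ cong (_* frac E (a ℕ.* b)) (frac-mul X₂ (b ℕ.^ j) Y₂ (n ℕ.^ j)) ⟩
  frac X₃ Y₃ * frac E (a ℕ.* b)
    ≡⟨ frac-mul X₃ E Y₃ (a ℕ.* b) ⟩
  frac (X₃ ℕ.* E) (Y₃ ℕ.* (a ℕ.* b))
    ≡⟨ cong₂ frac numerator denominator ⟩
  frac (S ℕ.* c) (m ℕ.* n ℕ.^ p ℕ.* V ℕ.* c)
    ≡⟨ frac-cancel S (m ℕ.* n ℕ.^ p ℕ.* V) c ⟩
  frac S (m ℕ.* n ℕ.^ p ℕ.* V) ∎)
  where
  open ≡-Reasoning
  E = k ℕ.* vA ℕ.* b ℕ.+ j ℕ.* vB ℕ.* a
  c = n ℕ.* (a ℕ.* b)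
  X₁ = n ℕ.* binom
  Y₁ = m ℕ.* V ℕ.* 1
  X₂ = X₁ ℕ.* a ℕ.^ k
  Y₂ = Y₁ ℕ.* n ℕ.^ k
  X₃ = X₂ ℕ.* b ℕ.^ j
  Y₃ = Y₂ ℕ.* n ℕ.^ j
  instance
    ab≢0 : NonZero (a ℕ.* b)
    ab≢0 = ℕP.m*n≢0 a b
    c≢0 : NonZero c
    c≢0 = ℕP.m*n≢0 n (a ℕ.* b)
  normaliser : ℕ→ℚ 1 ÷₀ (ℕ→ℚ m * frac V n) ≡ frac n (m ℕ.* V)
  normaliser = trans (cong (ℕ→ℚ 1 ÷₀_) (frac-scale m V n)) (frac-inv (m ℕ.* V) n)
  share-B : (ℕ→ℚ 1 ℚ.- frac a n) ^ℚ j ≡ frac (b ℕ.^ j) (n ℕ.^ j)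
  share-B = trans (cong (_^ℚ j) (frac-complement a b n b+a≡n)) (frac-pow b n j)
  mean-degree : ℕ→ℚ k * frac vA a + ℕ→ℚ j * frac vB b ≡ frac E (a ℕ.* b)
  mean-degree = trans (cong₂ _+_ (frac-scale k vA a) (frac-scale j vB b)) (frac-add (k ℕ.* vA) (j ℕ.* vB) a b)
  assoc : ∀ n binom x y E → n ℕ.* binom ℕ.* x ℕ.* y ℕ.* E ≡ n ℕ.* (binom ℕ.* x ℕ.* y ℕ.* E)
  assoc = solve-∀
  swap : ∀ n a b S → n ℕ.* (a ℕ.* b ℕ.* S) ≡ S ℕ.* (n ℕ.* (a ℕ.* b))
  swap = solve-∀
  numerator : X₃ ℕ.* E ≡ S ℕ.* c
  numerator = trans (assoc n binom (a ℕ.^ k) (b ℕ.^ j) E) (trans (cong (n ℕ.*_) (sym count-eq)) (swap n a b S))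
  gather : ∀ m V x y z → m ℕ.* V ℕ.* 1 ℕ.* x ℕ.* y ℕ.* z ≡ m ℕ.* V ℕ.* z ℕ.* (x ℕ.* y)
  gather = solve-∀
  spread : ∀ m V z n q → m ℕ.* V ℕ.* z ℕ.* (n ℕ.* q) ≡ m ℕ.* q ℕ.* V ℕ.* (n ℕ.* z)
  spread = solve-∀
  denominator : Y₃ ℕ.* (a ℕ.* b) ≡ m ℕ.* n ℕ.^ p ℕ.* V ℕ.* c
  denominator = trans (gather m V (n ℕ.^ k) (n ℕ.^ j) (a ℕ.* b))
    (trans (cong (m ℕ.* V ℕ.* (a ℕ.* b) ℕ.*_) power-eq) (spread m V (a ℕ.* b) n (n ℕ.^ p)))

lemma2 : (n : ℕ) (G : Digraph n) → Symmetric G → Connected G →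
    (m : ℕ) → 1 ≤ m →
    (A : Subset n) → 0 < ∣ A ∣ → ∣ A ∣ < n →
    (k : ℕ) → k ≤ m →
    probK G m A k ≡
      ((ℕ→ℚ 1 ÷₀ (ℕ→ℚ m * (ℕ→ℚ (vol G ⊤) ÷₀ ℕ→ℚ n)))
        * ℕ→ℚ (m C k)
        * ((ℕ→ℚ ∣ A ∣ ÷₀ ℕ→ℚ n) ^ℚ k)
        * ((ℕ→ℚ 1 Data.Rational.- (ℕ→ℚ ∣ A ∣ ÷₀ ℕ→ℚ n)) ^ℚ (m Data.Nat.∸ k))
        * (ℕ→ℚ k * (ℕ→ℚ (vol G A) ÷₀ ℕ→ℚ ∣ A ∣)
           + ℕ→ℚ (m Data.Nat.∸ k) * (ℕ→ℚ (vol G (∁ A)) ÷₀ ℕ→ℚ ∣ ∁ A ∣)))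
lemma2 n G _ _ (suc m) (s≤s z≤n) A 0<a a<n k k≤m =
  trans (probK-as-fraction (suc m) k)
        (fsFormula-from-count n a b (suc m) (vol G ⊤) (vol G A) (vol G (∁ A)) (degTotal (suc m) k)
                              (suc m C k) k (suc m ℕ.∸ k) m b+a≡n count-identity powers)
  where
  open Counts G A
  a = ∣ A ∣
  b = ∣ ∁ A ∣
  instance
    n≢0 : NonZero n
    n≢0 = ℕ.>-nonZero (ℕP.<-trans 0<a a<n)
    a≢0 : NonZero a
    a≢0 = ℕ.>-nonZero 0<a
    b≢0 : NonZero b
    b≢0 = ℕ.>-nonZero (subst (0 <_) (sym (∣∁p∣≡n∸∣p∣ A)) (ℕP.m<n⇒0<n∸m a<n))
  b+a≡n : b ℕ.+ a ≡ n
  b+a≡n = trans (cong (ℕ._+ a) (∣∁p∣≡n∸∣p∣ A)) (ℕP.m∸n+n≡m (∣p∣≤n A))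
  module Binomial = Solution a b count refl (λ _ → refl) count-step
  module Degrees = Binomial.Weighted (vol G A) (vol G (∁ A)) degTotal degTotal-base degTotal-step
  count-identity : a ℕ.* b ℕ.* degTotal (suc m) k
                   ≡ (suc m C k) ℕ.* a ℕ.^ k ℕ.* b ℕ.^ (suc m ℕ.∸ k) ℕ.* Degrees.weight (suc m) k
  count-identity = trans (Degrees.weighted (suc m) k) (cong (ℕ._* Degrees.weight (suc m) k) (Binomial.binomial (suc m) k))
  powers : n ℕ.^ k ℕ.* n ℕ.^ (suc m ℕ.∸ k) ≡ n ℕ.* n ℕ.^ m
  powers = trans (sym (ℕP.^-distribˡ-+-* n k (suc m ℕ.∸ k))) (cong (n ℕ.^_) (ℕP.m+[n∸m]≡n k≤m))
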